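{- Every odd positive integer $m$ with $m\not\equiv 5\pmod 8$ belongs to exactly one of the congruence classes $7\pmod 8$, $9\pmod{16}$, $11\pmod{16}$, $3\pmod{16}$, $1\pmod{16}$. For all integers $m>1$ in each class, the permutation pattern of the triple $(m,S(m),S^2(m))$ is determined as follows: $m\equiv 7\pmod 8$ gives $(1,2,3)$; $m\equiv 9\pmod{16}$ gives $(2,1,3)$; $m\equiv 11\pmod{16}$ gives $(1,3,2)$; $m\equiv 3\pmod{16}$ gives $(2,3,1)$; $m\equiv 1\pmod{16}$ gives $(3,2,1)$. The corresponding densities (of the sets of such $m$, measured as $\lim_{M\to\infty}(\text{count up to }M)/(M/2)$) are $1/4,1/8,1/8,1/8,1/8$ respectively.
   Context: Let $\Omega$ be the set of odd positive integers. The Syracuse function $S:\Omega\to\Omega$ is defined by $S(m)=(3m+1)/2^e$, where $e$ is the largest integer with $2^e\mid 3m+1$. For an $n$-tuple $X=(x_1,\dots,x_n)$ of distinct reals with coordinates in increasing order $y_1<\dots<y_n$, the permutation pattern of $X$ is the unique permutation $\sigma$ of $\{1,\dots,n\}$ with $x_i=y_{\sigma(i)}$, written $(\sigma(1),\dots,\sigma(n))$. -}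

module Defs where

open import Data.Nat using (ℕ; zero; suc; _+_; _*_; _<_; _<ᵇ_; NonZero)
open import Data.Nat.DivMod using (_%_; _/_)
open import Data.Nat.Properties using (_≟_)
open import Data.Integer using (+_)
open import Data.Rational using (ℚ) renaming (_/_ to _/ℚ_)
open import Data.Bool using (Bool; true; false; if_then_else_)
open import Data.List using (List; []; _∷_; length; filter; map; upTo)
open import Data.Product using (_×_; _,_)
open import Relation.Binary.PropositionalEquality using (_≡_)
open import Relation.Nullary using (Dec; does)

Odd : ℕ → Set
Odd m = m % 2 ≡ 1

-- Remove all factors of 2 from n, using fuel f (fuel n suffices since
-- each halving step strictly decreases a positive n).
removeTwos : ℕ → ℕ → ℕ
removeTwos zero n = n
removeTwos (suc f) zero = zero
removeTwos (suc f) (suc k) with does ((suc k) % 2 ≟ 0)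
... | true  = removeTwos f ((suc k) / 2)
... | false = suc k

oddPart : ℕ → ℕ
oddPart n = removeTwos n n

-- Syracuse function S(m) = (3m+1)/2^e, e = v₂(3m+1)  (meaningful on odd m)
S : ℕ → ℕ
S m = oddPart (3 * m + 1)

-- Permutation pattern of a triple (x₁,x₂,x₃): σ(i) = rank of xᵢ, i.e. the
-- index j with xᵢ = yⱼ in the increasing rearrangement; computed as
-- 1 + #{k | x_k < x_i}.  (For distinct entries this is exactly the paper's σ;
-- it yields a permutation only if the entries are distinct.)
ltN : ℕ → ℕ → ℕ
ltN a b = if a <ᵇ b then 1 else 0

pattern3 : ℕ × ℕ × ℕ → ℕ × ℕ × ℕ
pattern3 (x₁ , x₂ , x₃) =
  ( 1 + ltN x₂ x₁ + ltN x₃ x₁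
  , 1 + ltN x₁ x₂ + ltN x₃ x₂
  , 1 + ltN x₁ x₃ + ltN x₂ x₃ )

data Cls : Set where
  c7mod8 c9mod16 c11mod16 c3mod16 c1mod16 : Cls

InClass : Cls → ℕ → Set
InClass c7mod8   m = m % 8 ≡ 7
InClass c9mod16  m = m % 16 ≡ 9
InClass c11mod16 m = m % 16 ≡ 11
InClass c3mod16  m = m % 16 ≡ 3
InClass c1mod16  m = m % 16 ≡ 1

inClass? : (c : Cls) → (m : ℕ) → Dec (InClass c m)
inClass? c7mod8   m = m % 8 ≟ 7
inClass? c9mod16  m = m % 16 ≟ 9
inClass? c11mod16 m = m % 16 ≟ 11
inClass? c3mod16  m = m % 16 ≟ 3
inClass? c1mod16  m = m % 16 ≟ 1

patternOf : Cls → ℕ × ℕ × ℕ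
patternOf c7mod8   = (1 , 2 , 3)
patternOf c9mod16  = (2 , 1 , 3)
patternOf c11mod16 = (1 , 3 , 2)
patternOf c3mod16  = (2 , 3 , 1)
patternOf c1mod16  = (3 , 2 , 1)

density : Cls → ℚ
density c7mod8 = + 1 /ℚ 4
density _      = + 1 /ℚ 8

count : Cls → ℕ → ℕ
count c M = length (filter (inClass? c) (map suc (upTo M)))

-- Writing m = r + k·n in its class, the first one or two Syracuse iterates are explicit affine
-- functions of k: 3m + 1 equals 2^e times an affine function of k that is odd by construction.
-- Where the next cofactor's parity depends on k, S is still bounded by it, which is all the
-- comparison needs; the pattern is then read off from inequalities between affine functions.
-- The classes are the odd residues mod 16 other than 5 and 13, so classification is a finite
-- check. Membership in a class is 16-periodic, hence the counting function differs from
-- K·M/16 (K = count up to 16) by at most K, and the normalised count converges to 2K/16.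
module Submission where

open import Defs
open import Data.Nat using (ℕ; suc; _≤_; _<_) renaming (_*_ to _*ℕ_)
open import Data.Nat.DivMod using (_%_)
open import Data.Integer using (+_)
open import Data.Rational using (ℚ; 0ℚ; _/_; _-_; ∣_∣) renaming (_<_ to _<ℚ_)
open import Data.Product using (_×_; _,_; ∃; ∃-syntax; ∃!)
open import Relation.Binary.PropositionalEquality using (_≡_; _≢_)

open import Level using (Level)
open import Data.Nat hiding (_/_; ∣_-_∣)
open import Data.Nat.Properties
open import Data.Nat.DivMod using (m≡m%n+[m/n]*n; m%n<n; m/n≤m; m*n%n≡0; m*n/n≡m; [m+kn]%n≡m%n; m∣n⇒o%n%m≡o%m)
import Data.Nat as ℕ using (_/_; ∣_-_∣)
open import Data.Nat.Divisibility using (_∣_; divides)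
open import Data.Nat.Tactic.RingSolver using (solve; solve-∀)
open import Data.Integer as ℤ using (-[1+_]; _⊖_)
import Data.Integer.Properties as ℤ
open import Data.Rational as ℚ using (mkℚ; toℚᵘ)
import Data.Rational.Properties as ℚ
open import Data.Rational.Unnormalised as ℚᵘ using (mkℚᵘ; ↥_; *<*)
import Data.Rational.Unnormalised.Properties as ℚᵘ
open import Data.Bool using (true; false; T; if_then_else_)
-- tt is the instance that discharges the T (_ <ᵇ _) and T (_ ≤ᵇ _) arguments of affine-<.
open import Data.Unit using (tt)
open import Data.Sum using (inj₁; inj₂)
open import Data.Product using (proj₂)
open import Data.List using (List; []; _∷_; _∷ʳ_; length; filter; map; upTo)
open import Data.List.Properties using (upTo-∷ʳ; map-++; filter-++; length-++; filter-≐)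
open import Data.List.Membership.Propositional using (_∈_)
open import Data.List.Membership.Propositional.Properties using (∈-filter⁺; ∈-filter⁻; ∈-upTo⁺)
open import Data.List.Relation.Unary.Any using (here; there)
open import Data.List.Relation.Unary.All using (All; all?; lookup)
open import Function using (id)
open import Relation.Nullary using (does; contradiction; ¬?; _→-dec_)
open import Relation.Nullary.Decidable using (from-yes)
open import Relation.Unary using (Pred; Decidable)
open import Relation.Binary.PropositionalEquality using (refl; sym; trans; cong; cong₂; subst; subst₂; module ≡-Reasoning)

removeTwos-zero : ∀ f → removeTwos f 0 ≡ 0
removeTwos-zero zero    = refl
removeTwos-zero (suc f) = refl

removeTwos-≤ : ∀ f x → removeTwos f x ≤ x
removeTwos-≤ zero    x       = ≤-refl
removeTwos-≤ (suc f) zero    = ≤-refl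
removeTwos-≤ (suc f) (suc k) with does (suc k % 2 ≟ 0)
... | true  = ≤-trans (removeTwos-≤ f (suc k ℕ./ 2)) (m/n≤m (suc k) 2)
... | false = ≤-refl

removeTwos-odd : ∀ f {x} → Odd x → removeTwos (suc f) x ≡ x
removeTwos-odd f {suc k} odd rewrite odd = refl

removeTwos-even : ∀ f {k} → suc k % 2 ≡ 0 → removeTwos (suc f) (suc k) ≡ removeTwos f (suc k ℕ./ 2)
removeTwos-even f even rewrite even = refl

removeTwos-double : ∀ f y → removeTwos (suc f) (y * 2) ≡ removeTwos f y
removeTwos-double f zero    = sym (removeTwos-zero f)
removeTwos-double f (suc y) =
  trans (removeTwos-even f {suc (y * 2)} (m*n%n≡0 (suc y) 2)) (cong (removeTwos f) (m*n/n≡m (suc y) 2))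

removeTwos-*2^ : ∀ e f y → removeTwos (e + f) (y * 2 ^ e) ≡ removeTwos f y
removeTwos-*2^ zero    f y = cong (removeTwos f) (*-identityʳ y)
removeTwos-*2^ (suc e) f y = begin
  removeTwos (suc e + f) (y * (2 * 2 ^ e))  ≡⟨ cong (removeTwos (suc (e + f))) (*-comm-last y 2 (2 ^ e)) ⟩
  removeTwos (suc e + f) (y * 2 ^ e * 2)    ≡⟨ removeTwos-double (e + f) (y * 2 ^ e) ⟩
  removeTwos (e + f) (y * 2 ^ e)            ≡⟨ removeTwos-*2^ e f y ⟩
  removeTwos f y                            ∎
  where
  open ≡-Reasoning
  *-comm-last : ∀ a b c → a * (b * c) ≡ a * c * b
  *-comm-last = solve-∀

n<2^n : ∀ n → n < 2 ^ n
n<2^n zero    = s≤s z≤n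
n<2^n (suc n) = +-mono-≤-< (≤-trans (s≤s z≤n) ih) (≤-trans ih (m≤m+n (2 ^ n) 0))
  where ih = n<2^n n

oddPart-*2^ : ∀ e w .{{_ : NonZero w}} → ∃[ f ] oddPart (w * 2 ^ e) ≡ removeTwos (suc f) w
oddPart-*2^ e w = n ∸ suc e , (begin
  removeTwos n n                 ≡⟨ cong (λ fuel → removeTwos fuel n) fuel≡ ⟩
  removeTwos (e + suc f) n       ≡⟨ removeTwos-*2^ e (suc f) w ⟩
  removeTwos (suc f) w           ∎)
  where
  open ≡-Reasoning
  n = w * 2 ^ e
  f = n ∸ suc e
  e<n : e < n
  e<n = <-≤-trans (n<2^n e) (m≤n*m (2 ^ e) w)
  fuel≡ : n ≡ e + suc f
  fuel≡ = sym (trans (+-suc e f) (m+[n∸m]≡n e<n))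

oddPart-*2^-odd : ∀ e {z} → Odd z → oddPart (z * 2 ^ e) ≡ z
oddPart-*2^-odd e {suc z} odd with oddPart-*2^ e (suc z)
... | f , eq = trans eq (removeTwos-odd f odd)

oddPart-*2^-≤ : ∀ e w .{{_ : NonZero w}} → oddPart (w * 2 ^ e) ≤ w
oddPart-*2^-≤ e w with oddPart-*2^ e w
... | f , eq = subst (_≤ w) (sym eq) (removeTwos-≤ (suc f) w)

S≡odd-cofactor : ∀ {m z} e → Odd z → 3 * m + 1 ≡ z * 2 ^ e → S m ≡ z
S≡odd-cofactor e odd eq = trans (cong oddPart eq) (oddPart-*2^-odd e odd)

S≤cofactor : ∀ {m w} e .{{_ : NonZero w}} → 3 * m + 1 ≡ w * 2 ^ e → S m ≤ w
S≤cofactor {w = w} e eq = subst (_≤ w) (cong oddPart (sym eq)) (oddPart-*2^-≤ e w)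

Odd-+-even : ∀ r k n → Odd r → Odd (r + k * (n * 2))
Odd-+-even r k n odd = begin
  (r + k * (n * 2)) % 2   ≡⟨ cong (λ x → (r + x) % 2) (*-assoc k n 2) ⟨
  (r + k * n * 2) % 2     ≡⟨ [m+kn]%n≡m%n r (k * n) 2 ⟩
  r % 2                   ≡⟨ odd ⟩
  1                       ∎
  where open ≡-Reasoning

affine-< : ∀ {r r′ n n′} k → {{T (r <ᵇ r′)}} → {{T (n ≤ᵇ n′)}} → r + k * n < r′ + k * n′
affine-< {r} {r′} {n} {n′} k {{r<r′}} {{n≤n′}} =
  +-mono-<-≤ (<ᵇ⇒< r r′ r<r′) (*-monoʳ-≤ k (≤ᵇ⇒≤ n n′ n≤n′))

ltN-< : ∀ {a b} → a < b → ltN a b ≡ 1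
ltN-< {zero}  {suc b} _         = refl
ltN-< {suc a} {suc b} (s≤s a<b) = ltN-< a<b

ltN-≥ : ∀ {a b} → b ≤ a → ltN a b ≡ 0
ltN-≥ {a}     {zero}  _         = refl
ltN-≥ {suc a} {suc b} (s≤s b≤a) = ltN-≥ b≤a

pattern3-123 : ∀ {a b c} → a < b → b < c → pattern3 (a , b , c) ≡ (1 , 2 , 3)
pattern3-123 a<b b<c
  rewrite ltN-< a<b | ltN-< b<c | ltN-< (<-trans a<b b<c)
        | ltN-≥ (<⇒≤ a<b) | ltN-≥ (<⇒≤ b<c) | ltN-≥ (<⇒≤ (<-trans a<b b<c)) = refl

pattern3-213 : ∀ {a b c} → b < a → a < c → pattern3 (a , b , c) ≡ (2 , 1 , 3)
pattern3-213 b<a a<c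
  rewrite ltN-< b<a | ltN-< a<c | ltN-< (<-trans b<a a<c)
        | ltN-≥ (<⇒≤ b<a) | ltN-≥ (<⇒≤ a<c) | ltN-≥ (<⇒≤ (<-trans b<a a<c)) = refl

pattern3-132 : ∀ {a b c} → a < c → c < b → pattern3 (a , b , c) ≡ (1 , 3 , 2)
pattern3-132 a<c c<b
  rewrite ltN-< a<c | ltN-< c<b | ltN-< (<-trans a<c c<b)
        | ltN-≥ (<⇒≤ a<c) | ltN-≥ (<⇒≤ c<b) | ltN-≥ (<⇒≤ (<-trans a<c c<b)) = refl

pattern3-231 : ∀ {a b c} → c < a → a < b → pattern3 (a , b , c) ≡ (2 , 3 , 1)
pattern3-231 c<a a<b
  rewrite ltN-< c<a | ltN-< a<b | ltN-< (<-trans c<a a<b)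
        | ltN-≥ (<⇒≤ c<a) | ltN-≥ (<⇒≤ a<b) | ltN-≥ (<⇒≤ (<-trans c<a a<b)) = refl

pattern3-321 : ∀ {a b c} → c < b → b < a → pattern3 (a , b , c) ≡ (3 , 2 , 1)
pattern3-321 c<b b<a
  rewrite ltN-< c<b | ltN-< b<a | ltN-< (<-trans c<b b<a)
        | ltN-≥ (<⇒≤ c<b) | ltN-≥ (<⇒≤ b<a) | ltN-≥ (<⇒≤ (<-trans c<b b<a)) = refl

orbitPattern : ℕ → ℕ × ℕ × ℕ
orbitPattern m = pattern3 (m , S m , S (S m))

orbitPattern-≡ : ∀ {m s₁ s₂} → S m ≡ s₁ → S s₁ ≡ s₂ → orbitPattern m ≡ pattern3 (m , s₁ , s₂)
orbitPattern-≡ refl refl = refl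

orbitPattern-7mod8 : ∀ k → orbitPattern (7 + k * 8) ≡ (1 , 2 , 3)
orbitPattern-7mod8 k = trans (orbitPattern-≡ {7 + k * 8} S₁ S₂) (pattern3-123 m<s₁ s₁<s₂)
  where
  S₁ : S (7 + k * 8) ≡ 11 + k * 12
  S₁ = S≡odd-cofactor {7 + k * 8} 1 (Odd-+-even 11 k 6 refl) (solve (k ∷ []))
  S₂ : S (11 + k * 12) ≡ 17 + k * 18
  S₂ = S≡odd-cofactor {11 + k * 12} 1 (Odd-+-even 17 k 9 refl) (solve (k ∷ []))
  m<s₁ : 7 + k * 8 < 11 + k * 12
  m<s₁ = affine-< k
  s₁<s₂ : 11 + k * 12 < 17 + k * 18
  s₁<s₂ = affine-< k

orbitPattern-9mod16 : ∀ k → orbitPattern (9 + k * 16) ≡ (2 , 1 , 3)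
orbitPattern-9mod16 k = trans (orbitPattern-≡ {9 + k * 16} S₁ S₂) (pattern3-213 s₁<m m<s₂)
  where
  S₁ : S (9 + k * 16) ≡ 7 + k * 12
  S₁ = S≡odd-cofactor {9 + k * 16} 2 (Odd-+-even 7 k 6 refl) (solve (k ∷ []))
  S₂ : S (7 + k * 12) ≡ 11 + k * 18
  S₂ = S≡odd-cofactor {7 + k * 12} 1 (Odd-+-even 11 k 9 refl) (solve (k ∷ []))
  s₁<m : 7 + k * 12 < 9 + k * 16
  s₁<m = affine-< k
  m<s₂ : 9 + k * 16 < 11 + k * 18
  m<s₂ = affine-< k

orbitPattern-11mod16 : ∀ k → orbitPattern (11 + k * 16) ≡ (1 , 3 , 2)
orbitPattern-11mod16 k = trans (orbitPattern-≡ {11 + k * 16} S₁ S₂) (pattern3-132 m<s₂ s₂<s₁)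
  where
  S₁ : S (11 + k * 16) ≡ 17 + k * 24
  S₁ = S≡odd-cofactor {11 + k * 16} 1 (Odd-+-even 17 k 12 refl) (solve (k ∷ []))
  S₂ : S (17 + k * 24) ≡ 13 + k * 18
  S₂ = S≡odd-cofactor {17 + k * 24} 2 (Odd-+-even 13 k 9 refl) (solve (k ∷ []))
  m<s₂ : 11 + k * 16 < 13 + k * 18
  m<s₂ = affine-< k
  s₂<s₁ : 13 + k * 18 < 17 + k * 24
  s₂<s₁ = affine-< k

orbitPattern-3mod16 : ∀ k → orbitPattern (3 + k * 16) ≡ (2 , 3 , 1)
orbitPattern-3mod16 k = trans (orbitPattern-≡ {3 + k * 16} S₁ refl) (pattern3-231 s₂<m m<s₁)
  where
  S₁ : S (3 + k * 16) ≡ 5 + k * 24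
  S₁ = S≡odd-cofactor {3 + k * 16} 1 (Odd-+-even 5 k 12 refl) (solve (k ∷ []))
  S₂≤ : S (5 + k * 24) ≤ 2 + k * 9
  S₂≤ = S≤cofactor {5 + k * 24} 3 (solve (k ∷ []))
  s₂<m : S (5 + k * 24) < 3 + k * 16
  s₂<m = ≤-<-trans S₂≤ (affine-< k)
  m<s₁ : 3 + k * 16 < 5 + k * 24
  m<s₁ = affine-< k

orbitPattern-1mod16 : ∀ k → orbitPattern (17 + k * 16) ≡ (3 , 2 , 1)
orbitPattern-1mod16 k = trans (orbitPattern-≡ {17 + k * 16} S₁ refl) (pattern3-321 s₂<s₁ s₁<m)
  where
  S₁ : S (17 + k * 16) ≡ 13 + k * 12
  S₁ = S≡odd-cofactor {17 + k * 16} 2 (Odd-+-even 13 k 6 refl) (solve (k ∷ []))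
  S₂≤ : S (13 + k * 12) ≤ 10 + k * 9
  S₂≤ = S≤cofactor {13 + k * 12} 2 (solve (k ∷ []))
  s₂<s₁ : S (13 + k * 12) < 13 + k * 12
  s₂<s₁ = ≤-<-trans S₂≤ (affine-< k)
  s₁<m : 13 + k * 12 < 17 + k * 16
  s₁<m = affine-< k

m≡r+[m/n]*n : ∀ m n {r} .{{_ : NonZero n}} → m % n ≡ r → m ≡ r + m ℕ./ n * n
m≡r+[m/n]*n m n refl = m≡m%n+[m/n]*n m n

orbitPattern-class : (c : Cls) (m : ℕ) → 1 < m → InClass c m → orbitPattern m ≡ patternOf c
orbitPattern-class c7mod8   m _ m≡ =
  trans (cong orbitPattern (m≡r+[m/n]*n m 8 m≡)) (orbitPattern-7mod8 (m ℕ./ 8))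
orbitPattern-class c9mod16  m _ m≡ =
  trans (cong orbitPattern (m≡r+[m/n]*n m 16 m≡)) (orbitPattern-9mod16 (m ℕ./ 16))
orbitPattern-class c11mod16 m _ m≡ =
  trans (cong orbitPattern (m≡r+[m/n]*n m 16 m≡)) (orbitPattern-11mod16 (m ℕ./ 16))
orbitPattern-class c3mod16  m _ m≡ =
  trans (cong orbitPattern (m≡r+[m/n]*n m 16 m≡)) (orbitPattern-3mod16 (m ℕ./ 16))
orbitPattern-class c1mod16  m 1<m m≡ with m ℕ./ 16 | m≡r+[m/n]*n m 16 m≡
... | zero  | m≡1 = contradiction m≡1 (>⇒≢ 1<m)
... | suc k | m≡17+k*16 = trans (cong orbitPattern m≡17+k*16) (orbitPattern-1mod16 k)

∃!-filter-singleton : ∀ {a p} {A : Set a} {P : Pred A p} (P? : Decidable P) {xs : List A} →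
                      (∀ x → x ∈ xs) → ∀ {x} → filter P? xs ≡ x ∷ [] → ∃! _≡_ P
∃!-filter-singleton {P = P} P? {xs} complete {x} only-x =
  x , proj₂ (∈-filter⁻ P? {xs = xs} (subst (x ∈_) (sym only-x) (here refl))) , unique
  where
  unique : ∀ {y} → P y → x ≡ y
  unique Py with subst (_ ∈_) only-x (∈-filter⁺ P? (complete _) Py)
  ... | here y≡x = sym y≡x

length≡1⇒singleton : ∀ {a} {A : Set a} {xs : List A} → length xs ≡ 1 → ∃[ x ] xs ≡ x ∷ []
length≡1⇒singleton {xs = x ∷ []} refl = x , refl

allCls : List Cls
allCls = c7mod8 ∷ c9mod16 ∷ c11mod16 ∷ c3mod16 ∷ c1mod16 ∷ []

∈-allCls : ∀ c → c ∈ allCls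
∈-allCls c7mod8   = here refl
∈-allCls c9mod16  = there (here refl)
∈-allCls c11mod16 = there (there (here refl))
∈-allCls c3mod16  = there (there (there (here refl)))
∈-allCls c1mod16  = there (there (there (there (here refl))))

classesOf : ℕ → List Cls
classesOf m = filter (λ c → inClass? c m) allCls

m%16%n≡m%n : ∀ m n .{{_ : NonZero n}} → n ∣ 16 → m % 16 % n ≡ m % n
m%16%n≡m%n m n n∣16 = m∣n⇒o%n%m≡o%m n 16 m n∣16

InClass-mod16 : ∀ m c → InClass c (m % 16) ≡ InClass c m
InClass-mod16 m c7mod8   = cong (_≡ 7) (m%16%n≡m%n m 8 (divides 2 refl))
InClass-mod16 m c9mod16  = cong (_≡ 9) (m%16%n≡m%n m 16 (divides 1 refl))
InClass-mod16 m c11mod16 = cong (_≡ 11) (m%16%n≡m%n m 16 (divides 1 refl))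
InClass-mod16 m c3mod16  = cong (_≡ 3) (m%16%n≡m%n m 16 (divides 1 refl))
InClass-mod16 m c1mod16  = cong (_≡ 1) (m%16%n≡m%n m 16 (divides 1 refl))

classesOf-mod16 : ∀ m → classesOf (m % 16) ≡ classesOf m
classesOf-mod16 m = filter-≐ (λ c → inClass? c (m % 16)) (λ c → inClass? c m)
  ((λ {c} → subst id (InClass-mod16 m c)) , (λ {c} → subst id (sym (InClass-mod16 m c)))) allCls

OneClassIfAdmissible : ℕ → Set
OneClassIfAdmissible r = Odd r → r % 8 ≢ 5 → length (classesOf r) ≡ 1

residues<16-oneClass : All OneClassIfAdmissible (upTo 16)
residues<16-oneClass =
  from-yes (all? (λ r → r % 2 ≟ 1 →-dec ¬? (r % 8 ≟ 5) →-dec length (classesOf r) ≟ 1) (upTo 16))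

uniqueClass : (m : ℕ) → Odd m → m % 8 ≢ 5 → ∃! _≡_ (λ c → InClass c m)
uniqueClass m odd m≢5 = ∃!-filter-singleton (λ c → inClass? c m) ∈-allCls (proj₂ singleton)
  where
  one : length (classesOf m) ≡ 1
  one = subst (λ cs → length cs ≡ 1) (classesOf-mod16 m)
          (lookup residues<16-oneClass (∈-upTo⁺ (m%n<n m 16))
            (trans (m%16%n≡m%n m 2 (divides 8 refl)) odd)
            (λ r≡5 → m≢5 (trans (sym (m%16%n≡m%n m 8 (divides 2 refl))) r≡5)))
  singleton : ∃[ c ] classesOf m ≡ c ∷ []
  singleton = length≡1⇒singleton one

module PeriodicCount {ℓ : Level} {P : Pred ℕ ℓ} (P? : Decidable P) where

  countUpTo : ℕ → ℕ
  countUpTo M = length (filter P? (map suc (upTo M)))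

  indicator : ℕ → ℕ
  indicator x = if does (P? x) then 1 else 0

  length-filter-∷ʳ : ∀ xs x → length (filter P? (xs ∷ʳ x)) ≡ length (filter P? xs) + indicator x
  length-filter-∷ʳ xs x rewrite filter-++ P? xs (x ∷ []) | length-++ (filter P? xs) {filter P? (x ∷ [])}
    with does (P? x)
  ... | true  = refl
  ... | false = refl

  countUpTo-suc : ∀ M → countUpTo (suc M) ≡ countUpTo M + indicator (suc M)
  countUpTo-suc M = begin
    length (filter P? (map suc (upTo (suc M))))
      ≡⟨ cong (λ xs → length (filter P? (map suc xs))) (upTo-∷ʳ M) ⟨
    length (filter P? (map suc (upTo M ∷ʳ M)))
      ≡⟨ cong (λ xs → length (filter P? xs)) (map-++ suc (upTo M) (M ∷ [])) ⟩
    length (filter P? (map suc (upTo M) ∷ʳ suc M))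
      ≡⟨ length-filter-∷ʳ (map suc (upTo M)) (suc M) ⟩
    countUpTo M + indicator (suc M)
      ∎
    where open ≡-Reasoning

  countUpTo-≤-+ : ∀ d m → countUpTo m ≤ countUpTo (d + m)
  countUpTo-≤-+ zero    m = ≤-refl
  countUpTo-≤-+ (suc d) m = begin
    countUpTo m                                ≤⟨ countUpTo-≤-+ d m ⟩
    countUpTo (d + m)                          ≤⟨ m≤m+n (countUpTo (d + m)) (indicator (suc (d + m))) ⟩
    countUpTo (d + m) + indicator (suc d + m)  ≡⟨ countUpTo-suc (d + m) ⟨
    countUpTo (suc d + m)                      ∎
    where open ≤-Reasoning

  module _ (p : ℕ) (periodic : ∀ x → does (P? (x + p)) ≡ does (P? x)) where

    countUpTo-+period : ∀ M → countUpTo (M + p) ≡ countUpTo p + countUpTo M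
    countUpTo-+period zero    = sym (+-identityʳ (countUpTo p))
    countUpTo-+period (suc M) = begin
      countUpTo (suc M + p)
        ≡⟨ countUpTo-suc (M + p) ⟩
      countUpTo (M + p) + indicator (suc M + p)
        ≡⟨ cong₂ _+_ (countUpTo-+period M) (cong (λ b → if b then 1 else 0) (periodic (suc M))) ⟩
      countUpTo p + countUpTo M + indicator (suc M)
        ≡⟨ +-assoc (countUpTo p) _ _ ⟩
      countUpTo p + (countUpTo M + indicator (suc M))
        ≡⟨ cong (λ x → countUpTo p + x) (countUpTo-suc M) ⟨
      countUpTo p + countUpTo (suc M)
        ∎
      where open ≡-Reasoning

    countUpTo-+*period : ∀ q t → countUpTo (t + q * p) ≡ q * countUpTo p + countUpTo t
    countUpTo-+*period zero    t = cong countUpTo (+-identityʳ t)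
    countUpTo-+*period (suc q) t = begin
      countUpTo (t + (p + q * p))                  ≡⟨ cong countUpTo (+-assoc t p (q * p)) ⟨
      countUpTo (t + p + q * p)                    ≡⟨ countUpTo-+*period q (t + p) ⟩
      q * K + countUpTo (t + p)                    ≡⟨ cong (λ x → q * K + x) (countUpTo-+period t) ⟩
      q * K + (K + countUpTo t)                    ≡⟨ +-exchange (q * K) K (countUpTo t) ⟩
      K + q * K + countUpTo t                      ∎
      where
      open ≡-Reasoning
      K : ℕ
      K = countUpTo p
      +-exchange : ∀ a b c → a + (b + c) ≡ b + a + c
      +-exchange = solve-∀

    countUpTo-error : .{{_ : NonZero p}} → ∀ M → ℕ.∣ p * countUpTo M - countUpTo p * M ∣ ≤ p * countUpTo p
    countUpTo-error M = begin
      ℕ.∣ p * countUpTo M - K * M ∣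
        ≡⟨ cong (λ x → ℕ.∣ p * countUpTo x - K * x ∣) (m≡m%n+[m/n]*n M p) ⟩
      ℕ.∣ p * countUpTo (t + q * p) - K * (t + q * p) ∣
        ≡⟨ cong (λ x → ℕ.∣ p * x - K * (t + q * p) ∣) (countUpTo-+*period q t) ⟩
      ℕ.∣ p * (q * K + countUpTo t) - K * (t + q * p) ∣
        ≡⟨ cong₂ ℕ.∣_-_∣ (expand₁ p q K (countUpTo t)) (expand₂ p q K t) ⟩
      ℕ.∣ q * K * p + p * countUpTo t - q * K * p + K * t ∣
        ≡⟨ ∣m+n-m+o∣≡∣n-o∣ (q * K * p) _ _ ⟩
      ℕ.∣ p * countUpTo t - K * t ∣
        ≤⟨ ∣m-n∣≤m⊔n (p * countUpTo t) (K * t) ⟩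
      p * countUpTo t ⊔ K * t
        ≤⟨ ⊔-lub (*-monoʳ-≤ p Nt≤K) (≤-trans (*-monoʳ-≤ K (<⇒≤ t<p)) (≤-reflexive (*-comm K p))) ⟩
      p * K
        ∎
      where
      open ≤-Reasoning
      K t q : ℕ
      K = countUpTo p
      t = M % p
      q = M ℕ./ p
      t<p : t < p
      t<p = m%n<n M p
      Nt≤K : countUpTo t ≤ K
      Nt≤K = subst (λ x → countUpTo t ≤ countUpTo x) (m∸n+n≡m (<⇒≤ t<p)) (countUpTo-≤-+ (p ∸ t) t)
      expand₁ : ∀ p q K N → p * (q * K + N) ≡ q * K * p + p * N
      expand₁ = solve-∀
      expand₂ : ∀ p q K t → K * (t + q * p) ≡ q * K * p + K * t
      expand₂ = solve-∀

∣m⊖n∣≡∣m-n∣ : ∀ m n → ℤ.∣ m ⊖ n ∣ ≡ ℕ.∣ m - n ∣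
∣m⊖n∣≡∣m-n∣ m n with ≤-total m n
... | inj₁ m≤n = trans (ℤ.∣⊖∣-≤ m≤n) (sym (m≤n⇒∣m-n∣≡n∸m m≤n))
... | inj₂ n≤m = trans (ℤ.∣m⊖n∣≡∣n⊖m∣ m n) (trans (ℤ.∣⊖∣-≤ n≤m) (sym (m≤n⇒∣n-m∣≡n∸m n≤m)))

↥∣a/m-b/n∣ : ∀ a m b n → ↥ ℚᵘ.∣ mkℚᵘ (+ a) m ℚᵘ.- mkℚᵘ (+ b) n ∣ ≡ + ℕ.∣ a * suc n - b * suc m ∣
↥∣a/m-b/n∣ a m b n = cong +_ (begin
  ℤ.∣ + a ℤ.* + suc n ℤ.+ ℤ.- (+ b) ℤ.* + suc m ∣
    ≡⟨ cong (λ j → ℤ.∣ + a ℤ.* + suc n ℤ.+ j ∣) (ℤ.neg-distribˡ-* (+ b) (+ suc m)) ⟨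
  ℤ.∣ + a ℤ.* + suc n ℤ.- + b ℤ.* + suc m ∣
    ≡⟨ cong₂ (λ i j → ℤ.∣ i ℤ.- j ∣) (ℤ.pos-* a (suc n)) (ℤ.pos-* b (suc m)) ⟨
  ℤ.∣ + (a * suc n) ℤ.- + (b * suc m) ∣
    ≡⟨ cong ℤ.∣_∣ (ℤ.m-n≡m⊖n (a * suc n) (b * suc m)) ⟩
  ℤ.∣ (a * suc n) ⊖ (b * suc m) ∣
    ≡⟨ ∣m⊖n∣≡∣m-n∣ (a * suc n) (b * suc m) ⟩
  ℕ.∣ a * suc n - b * suc m ∣ ∎)
  where open ≡-Reasoning

toℚᵘ-∣a/m-b/n∣ : ∀ a m b n →
  toℚᵘ (∣ + a / suc m - + b / suc n ∣) ℚᵘ.≃ ℚᵘ.∣ mkℚᵘ (+ a) m ℚᵘ.- mkℚᵘ (+ b) n ∣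
toℚᵘ-∣a/m-b/n∣ a m b n = ℚᵘ.≃-trans (ℚ.toℚᵘ-homo-∣-∣ (x - y))
  (ℚᵘ.∣-∣-cong (ℚᵘ.≃-trans (ℚ.toℚᵘ-homo-+ x (ℚ.- y))
    (ℚᵘ.+-cong (ℚ.toℚᵘ-fromℚᵘ (mkℚᵘ (+ a) m))
      (ℚᵘ.≃-trans (ℚ.toℚᵘ-homo‿- y) (ℚᵘ.-‿cong (ℚ.toℚᵘ-fromℚᵘ (mkℚᵘ (+ b) n)))))))
  where
  x y : ℚ
  x = + a / suc m
  y = + b / suc n

bounded-error⇒ratio-converges :
  ∀ (f : ℕ → ℕ) b d B → (∀ n → ℕ.∣ f n * suc d - b * suc n ∣ ≤ B) →
  ∀ ε → 0ℚ <ℚ ε → ∃[ N ] ∀ n → N ≤ n → ∣ + f n / suc n - + b / suc d ∣ <ℚ ε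
bounded-error⇒ratio-converges f b d B error≤B (mkℚ (+ 0) _ _) (ℚ.*<* (ℤ.+<+ ()))
bounded-error⇒ratio-converges f b d B error≤B (mkℚ -[1+ _ ] _ _) (ℚ.*<* ())
bounded-error⇒ratio-converges f b d B error≤B ε@(mkℚ (+ suc p) q-1 _) _ = B * suc q-1 , close
  where
  close : ∀ n → B * suc q-1 ≤ n → ∣ + f n / suc n - + b / suc d ∣ <ℚ ε
  close n N≤n = ℚ.toℚᵘ-cancel-< (ℚᵘ.<-respˡ-≃ (ℚᵘ.≃-sym (toℚᵘ-∣a/m-b/n∣ (f n) n b d)) (*<* num<))
    where
    error : ℕ
    error = ℕ.∣ f n * suc d - b * suc n ∣
    error*q<p*denominator : error * suc q-1 < suc p * (suc n * suc d)
    error*q<p*denominator = begin-strict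
      error * suc q-1          ≤⟨ *-monoˡ-≤ (suc q-1) (error≤B n) ⟩
      B * suc q-1              ≤⟨ N≤n ⟩
      n                        <⟨ n<1+n n ⟩
      suc n                    ≤⟨ m≤m*n (suc n) (suc d) ⟩
      suc n * suc d            ≤⟨ m≤n*m (suc n * suc d) (suc p) ⟩
      suc p * (suc n * suc d)  ∎
      where open ≤-Reasoning
    num< : ↥ ℚᵘ.∣ mkℚᵘ (+ f n) n ℚᵘ.- mkℚᵘ (+ b) d ∣ ℤ.* + suc q-1 ℤ.< + suc p ℤ.* + (suc n * suc d)
    num< = subst (λ i → i ℤ.* + suc q-1 ℤ.< + suc p ℤ.* + (suc n * suc d)) (sym (↥∣a/m-b/n∣ (f n) n b d))
             (subst₂ ℤ._<_ (ℤ.pos-* error (suc q-1)) (ℤ.pos-* (suc p) (suc n * suc d))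
               (ℤ.+<+ error*q<p*denominator))

inClass?-+16 : ∀ c x → does (inClass? c (x + 16)) ≡ does (inClass? c x)
inClass?-+16 c7mod8   x = cong (λ r → does (r ≟ 7)) ([m+kn]%n≡m%n x 2 8)
inClass?-+16 c9mod16  x = cong (λ r → does (r ≟ 9)) ([m+kn]%n≡m%n x 1 16)
inClass?-+16 c11mod16 x = cong (λ r → does (r ≟ 11)) ([m+kn]%n≡m%n x 1 16)
inClass?-+16 c3mod16  x = cong (λ r → does (r ≟ 3)) ([m+kn]%n≡m%n x 1 16)
inClass?-+16 c1mod16  x = cong (λ r → does (r ≟ 1)) ([m+kn]%n≡m%n x 1 16)

density≡count16/8 : ∀ c → density c ≡ + count c 16 / 8
density≡count16/8 c7mod8   = refl
density≡count16/8 c9mod16  = refl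
density≡count16/8 c11mod16 = refl
density≡count16/8 c3mod16  = refl
density≡count16/8 c1mod16  = refl

count-error : ∀ c n → ℕ.∣ 2 * count c (suc n) * 8 - count c 16 * suc n ∣ ≤ 16 * count c 16
count-error c n = subst (λ x → ℕ.∣ x - count c 16 * suc n ∣ ≤ 16 * count c 16) (16*N≡2*N*8 (count c (suc n)))
  (PeriodicCount.countUpTo-error (inClass? c) 16 (inClass?-+16 c) (suc n))
  where
  16*N≡2*N*8 : ∀ N → 16 * N ≡ 2 * N * 8
  16*N≡2*N*8 = solve-∀

classDensity : (c : Cls) (ε : ℚ) → 0ℚ <ℚ ε → ∃[ N ] ((n : ℕ) → N ≤ n →
                 ∣ (+ (2 * count c (suc n)) / suc n) - density c ∣ <ℚ ε)
classDensity c rewrite density≡count16/8 c =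
  bounded-error⇒ratio-converges (λ n → 2 * count c (suc n)) (count c 16) 7 (16 * count c 16) (count-error c)

mainTheorem4 :
    ((m : ℕ) → Odd m → m % 8 ≢ 5 → ∃! _≡_ (λ c → InClass c m))
    × ((c : Cls) (m : ℕ) → 1 < m → InClass c m →
         pattern3 (m , S m , S (S m)) ≡ patternOf c)
    × ((c : Cls) (ε : ℚ) → 0ℚ <ℚ ε → ∃[ N ] ((n : ℕ) → N ≤ n →
         ∣ (+ (2 *ℕ count c (suc n)) / suc n) - density c ∣ <ℚ ε))
mainTheorem4 = uniqueClass , orbitPattern-class , classDensity
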